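{- Let $(P,\Pi\cup\theta\Pi)$ be a permutation-bipartition pair on $S\cup S_\theta$, and let $a,b\in S$ with $a\neq b$ and $a\equiv b \pmod{\Pi}$. Then $(P_{a,\theta a},\Pi_a\cup\theta\Pi_a)=(P,\Pi\cup\theta\Pi)|^{a\rightarrow b}_{\theta a\rightarrow\theta b}$ is also a permutation-bipartition pair (on $(S\setminus\{b\})\cup(S_\theta\setminus\{\theta b\})$).
   Context: Let $S$ and $S_\theta$ be disjoint finite sets of equal size and let $\theta$ be a fixed-point-free involution of $S\cup S_\theta$ mapping $S$ bijectively onto $S_\theta$ (so $\theta\theta x=x$). Permutations act on the right: $xP$ is the image of $x$ under $P$, products are composed left to right, $x(PQ)=(xP)Q$, and a cycle $(x_1,x_2,\ldots,x_m)$ means $x_iP=x_{i+1}$, $x_mP=x_1$. A permutation-bipartition pair $(P,\Pi\cup\theta\Pi)$ consists of a permutation $P$ of $S\cup S_\theta$ such that whenever $(x_1,x_2,\ldots,x_m)$ is a cycle of $P$, then $(\theta x_1,\theta x_m,\ldots,\theta x_2)$ is also a cycle of $P$, together with a partition $\Pi=\{\Pi_1,\ldots,\Pi_k\}$ of $S$ and the induced partition $\theta\Pi=\{\theta\Pi_1,\ldots,\theta\Pi_k\}$ of $S_\theta$. Write $a\equiv b\pmod{\Pi}$ if $a,b$ lie in the same block of $\Pi$. For an element $x$, $P/x$ is the permutation obtained by deleting $x$ from the disjoint cycle decomposition of $P$, and $\Pi-x$ is the partition obtained by deleting $x$ from the block containing it (discarding an empty block). For $a\neq b$ with $a\equiv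 b\pmod\Pi$, define $\Pi_a=\Pi-b$, $\theta\Pi_a=\theta\Pi-\theta b$, $P_a=P(b,a,bP)/b$ if $a\neq bP\neq b$; $P_a=P(b,a)/b$ if $a=bP\neq b$; $P_a=P/b$ if $bP=b$; and $P_{a,\theta a}=(\theta a,\theta b,\theta bP_a^{ -1})P_a/\theta b$ if $\theta a\neq \theta bP_a^{ -1}\neq\theta b$; $P_{a,\theta a}=(\theta b,\theta a)P_a/\theta b$ if $\theta a=\theta bP_a^{ -1}\neq\theta b$; $P_{a,\theta a}=P_a/\theta b$ if $\theta bP_a^{ -1}=\theta b$. The reduced pair is $(P,\Pi\cup\theta\Pi)|^{a\rightarrow b}_{\theta a\rightarrow\theta b}:=(P_{a,\theta a},\Pi_a\cup\theta\Pi_a)$. -}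

module Defs where

open import Data.List using (List; []; _∷_; _++_; map; reverse; concat; filter)
open import Data.List.Membership.Propositional using (_∈_; _∉_)
open import Data.List.Relation.Unary.All using (All)
open import Data.List.Relation.Unary.Any using (Any)
open import Data.List.Relation.Unary.Unique.Propositional using (Unique)
open import Data.List.Relation.Binary.Permutation.Propositional using (_↭_)
open import Data.Product using (_×_; Σ)
open import Data.Unit using (⊤)
open import Data.Empty using (⊥)
open import Relation.Nullary using (¬_; yes; no; ¬?)
open import Relation.Binary.Definitions using (DecidableEquality)
open import Relation.Binary.PropositionalEquality using (_≡_; _≢_)

-- The ground set S ∪ S_θ is represented by the duplicate-free list
-- S ++ map θ S (so S_θ := map θ S = θ S).
-- Permutations act on the right; "x P" is written  P x  (a function A → A),
-- and only its values on the ground set matter.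
module _ {A : Set} (_≟_ : DecidableEquality A) where

  remove : A → List A → List A
  remove x = filter (λ y → ¬? (y ≟ x))

  ground : (A → A) → List A → List A
  ground θ S = S ++ map θ S

  Setup : List A → (A → A) → Set
  Setup S θ = Unique S
            × (∀ x → x ∈ S → θ x ∉ S)
            × (∀ x → x ∈ ground θ S → θ (θ x) ≡ x)

  IsPerm : List A → (A → A) → Set
  IsPerm D P = (∀ x → x ∈ D → P x ∈ D)
             × (∀ x y → x ∈ D → y ∈ D → P x ≡ P y → x ≡ y)

  Steps : (A → A) → List A → Set
  Steps P [] = ⊤
  Steps P (x ∷ []) = ⊤
  Steps P (x ∷ y ∷ r) = (P x ≡ y) × Steps P (y ∷ r)

  last : A → List A → A
  last x [] = x
  last x (y ∷ r) = last y r

  IsCycle : List A → (A → A) → List A → Set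
  IsCycle D P [] = ⊥
  IsCycle D P (x ∷ r) = Unique (x ∷ r) × All (_∈ D) (x ∷ r)
                      × Steps P (x ∷ r) × (P (last x r) ≡ x)

  IsPartition : List A → List (List A) → Set
  IsPartition S Π = All (λ B → B ≢ []) Π × (concat Π ↭ S)

  -- permutation-bipartition pair (P , Π ∪ θΠ) on S ∪ S_θ
  -- (θΠ = map (map θ) Π is induced by Π and θ)
  PBPair : List A → (A → A) → (A → A) → List (List A) → Set
  PBPair S θ P Π =
      IsPerm (ground θ S) P
    × (∀ x r → IsCycle (ground θ S) P (x ∷ r)
             → IsCycle (ground θ S) P (θ x ∷ map θ (reverse r)))
    × IsPartition S Π

  consNE : List A → List (List A) → List (List A)
  consNE [] Π = Π
  consNE (y ∷ B) Π = (y ∷ B) ∷ Π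

  delPart : A → List (List A) → List (List A)
  delPart x [] = []
  delPart x (B ∷ Π) = consNE (remove x B) (delPart x Π)

  _⨾_ : (A → A) → (A → A) → A → A
  (P ⨾ Q) x = Q (P x)

  swap : A → A → A → A
  swap x y z with z ≟ x | z ≟ y
  ... | yes _ | _ = y
  ... | no _ | yes _ = x
  ... | no _ | no _ = z

  cyc3 : A → A → A → A → A
  cyc3 x y z w with w ≟ x | w ≟ y | w ≟ z
  ... | yes _ | _ | _ = y
  ... | no _ | yes _ | _ = z
  ... | no _ | no _ | yes _ = x
  ... | no _ | no _ | no _ = w

  -- P / x : delete x from the cycle decomposition of P
  -- (x itself is no longer in the ground set; its value is set to x)
  del : (A → A) → A → A → A
  del P x y with y ≟ x | P y ≟ x
  ... | yes _ | _ = x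
  ... | no _ | yes _ = P x
  ... | no _ | no _ = P y

  preimage : (A → A) → List A → A → A
  preimage f [] t = t
  preimage f (y ∷ L) t with f y ≟ t
  ... | yes _ = y
  ... | no _ = preimage f L t

  Pa : (A → A) → A → A → A → A
  Pa P a b with P b ≟ b | a ≟ P b
  ... | yes _ | _ = del P b
  ... | no _ | yes _ = del (P ⨾ swap b a) b
  ... | no _ | no _ = del (P ⨾ cyc3 b a (P b)) b

  -- P_{a,θa}; the inverse P_a⁻¹ is computed on the ground set minus b
  Paθa : List A → (A → A) → (A → A) → A → A → A → A
  Paθa S θ P a b with preimage (Pa P a b) (remove b (ground θ S)) (θ b)
  ... | c with c ≟ θ b | θ a ≟ c
  ...   | yes _ | _ = del (Pa P a b) (θ b)
  ...   | no _ | yes _ = del (swap (θ b) (θ a) ⨾ Pa P a b) (θ b)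
  ...   | no _ | no _ = del (cyc3 (θ a) (θ b) c ⨾ Pa P a b) (θ b)

  SameBlock : List (List A) → A → A → Set
  SameBlock Π a b = Any (λ B → a ∈ B × b ∈ B) Π

module Submission where

-- The condition on cycles is equivalent to the pointwise identity x P θ P = x θ, i.e. θ P θ = P⁻¹:
-- P traverses the mirror of a cycle exactly when this identity holds along it, and every point of a
-- finite set lies on a cycle.  Both reductions multiply by a short cycle and delete a point:
-- P_a = P ρ / b with ρ ∈ {1, (b,a), (b,a,bP)} chosen so that b P ρ = b, and P_{a,θa} = τ P_a / θb
-- with τ ∈ {1, (θb,θa), (θa,θb,c)}, c = θb P_a⁻¹.  The product G = (θ ρ⁻¹ θ) P ρ again satisfies
-- θ G θ = G⁻¹, and b is either fixed by G or directly follows θb.  Deleting the pair {b, θb} from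
-- the cycles of such a G preserves the identity, and a short case check shows that the result is
-- P_{a,θa} on (S∖{b}) ∪ θ(S∖{b}).

open import Defs
open import Data.Nat using (ℕ; zero; suc; _+_; _<_; s≤s)
open import Data.Nat.Properties using (anyUpTo?; m≤n⇒∃[o]m+o≡n; +-suc; ≤-refl; ≤-pred; m≤n+m; ≤-trans)
open import Data.Nat.Induction using (<-rec)
open import Data.Nat.GeneralisedArithmetic using (iterate)
open import Data.Fin using (toℕ)
open import Data.Fin.Properties using (pigeonhole)
open import Data.List using (List; []; _∷_; _++_; _∷ʳ_; concat; map; reverse; reverseAcc; lookup; applyUpTo)
open import Data.List.Properties using (unfold-reverse; reverse-++; map-++; map-∘; map-id-local; filter-++)
open import Data.List.Membership.Propositional using (_∈_; _∉_)
open import Data.List.Membership.Propositional.Properties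
  using (∈-++⁺ˡ; ∈-++⁺ʳ; ∈-++⁻; ∈-map⁺; ∈-map⁻; ∈-filter⁺; ∈-filter⁻)
open import Data.List.Relation.Unary.All as All using (All; []; _∷_)
open import Data.List.Relation.Unary.All.Properties using (applyUpTo⁺₁; ∷ʳ⁺) renaming (map⁺ to All-map⁺)
open import Data.List.Relation.Unary.Any using (index; here; there)
open import Data.List.Relation.Unary.Any.Properties using (lookup-index)
open import Data.List.Relation.Unary.Unique.Propositional using (Unique)
open import Data.List.Relation.Unary.Unique.Propositional.Properties
  using (map⁻; filter⁺) renaming (applyUpTo⁺₁ to Unique-applyUpTo⁺₁)
open import Data.List.Relation.Binary.Permutation.Propositional using (_↭_; ↭-prep; ↭-sym; ↭⇒↭ₛ)
open import Data.List.Relation.Binary.Permutation.Propositional.Properties using (↭-reverse; All-resp-↭; filter-↭)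
open import Data.List.Relation.Binary.Permutation.Setoid.Properties using (Unique-resp-↭)
open import Data.Product using (_×_; _,_; ∃-syntax; proj₁; proj₂; uncurry)
open import Data.Unit using (tt)
open import Data.Sum using (_⊎_; inj₁; inj₂; [_,_])
open import Data.Empty using (⊥-elim)
open import Relation.Nullary using (Dec; yes; no; ¬?)
open import Relation.Binary.Definitions using (DecidableEquality)
open import Relation.Binary.PropositionalEquality
  using (_≡_; _≢_; refl; sym; trans; cong; subst; setoid; ≢-sym; module ≡-Reasoning)

-- θ P θ = P⁻¹ on D, i.e. x P θ P = x θ in the right-action notation.
InvertedBy : {A : Set} → List A → (A → A) → (A → A) → Set
InvertedBy D θ P = ∀ y → y ∈ D → P (θ (P y)) ≡ θ y

CyclesMirrored : {A : Set} → DecidableEquality A → List A → (A → A) → (A → A) → Set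
CyclesMirrored _≟_ D θ P =
  ∀ x r → IsCycle _≟_ D P (x ∷ r) → IsCycle _≟_ D P (θ x ∷ map θ (reverse r))

module Walks {A : Set} (_≟_ : DecidableEquality A) (P : A → A) where

  steps-∷ʳ⁺ : ∀ x ws {v} → Steps _≟_ P (x ∷ ws) → P (last _≟_ x ws) ≡ v → Steps _≟_ P (x ∷ ws ∷ʳ v)
  steps-∷ʳ⁺ x []       _            e = e , tt
  steps-∷ʳ⁺ x (w ∷ ws) (Px≡w , st)  e = Px≡w , steps-∷ʳ⁺ w ws st e

  steps-∷ʳ⁻ : ∀ x ws {v} → Steps _≟_ P (x ∷ ws ∷ʳ v) → Steps _≟_ P (x ∷ ws) × P (last _≟_ x ws) ≡ v
  steps-∷ʳ⁻ x []       (e , _)      = tt , e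
  steps-∷ʳ⁻ x (w ∷ ws) (Px≡w , st)  = let st′ , e = steps-∷ʳ⁻ w ws st in (Px≡w , st′) , e

  last-∷ʳ : ∀ x ws v → last _≟_ x (ws ∷ʳ v) ≡ v
  last-∷ʳ x []       v = refl
  last-∷ʳ x (w ∷ ws) v = last-∷ʳ w ws v

module Orbits {A : Set} (_≟_ : DecidableEquality A) (D : List A) (P : A → A)
  (P-closed : ∀ x → x ∈ D → P x ∈ D)
  (P-injective : ∀ x y → x ∈ D → y ∈ D → P x ≡ P y → x ≡ y) where

  iterate-suc : ∀ y k → iterate P y (suc k) ≡ P (iterate P y k)
  iterate-suc y zero    = refl
  iterate-suc y (suc k) = iterate-suc (P y) k

  iterate-closed : ∀ {y} k → y ∈ D → iterate P y k ∈ D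
  iterate-closed zero    y∈D = y∈D
  iterate-closed (suc k) y∈D = iterate-closed k (P-closed _ y∈D)

  iterate-cancel : ∀ {y} i k → y ∈ D → iterate P y i ≡ iterate P y (i + k) → y ≡ iterate P y k
  iterate-cancel zero    k y∈D e = e
  iterate-cancel (suc i) k y∈D e =
    P-injective _ _ y∈D (iterate-closed k y∈D)
      (trans (iterate-cancel i k (P-closed _ y∈D) e) (iterate-suc _ k))

  period : ∀ {y} → y ∈ D → ∃[ n ] iterate P y (suc n) ≡ y
  period {y} y∈D with pigeonhole ≤-refl (λ k → index (iterate-closed (toℕ k) y∈D))
  ... | i , j , i<j , same-index with m≤n⇒∃[o]m+o≡n i<j
  ...   | o , i+1+o≡j = o , sym (iterate-cancel (toℕ i) (suc o) y∈D (begin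
          iterate P y (toℕ i)         ≡⟨ lookup-index (iterate-closed (toℕ i) y∈D) ⟩
          lookup D _                  ≡⟨ cong (lookup D) same-index ⟩
          lookup D _                  ≡⟨ sym (lookup-index (iterate-closed (toℕ j) y∈D)) ⟩
          iterate P y (toℕ j)         ≡⟨ cong (iterate P y) (trans (sym i+1+o≡j) (sym (+-suc (toℕ i) o))) ⟩
          iterate P y (toℕ i + suc o) ∎))
    where open ≡-Reasoning

  MinimalPeriod : A → ℕ → Set
  MinimalPeriod y n = iterate P y (suc n) ≡ y × (∀ {k} → k < n → iterate P y (suc k) ≢ y)

  minimal-period : ∀ {y} m → iterate P y (suc m) ≡ y → ∃[ n ] MinimalPeriod y n
  minimal-period {y} = <-rec (λ m → iterate P y (suc m) ≡ y → ∃[ n ] MinimalPeriod y n) search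
    where
    search : ∀ m → (∀ {k} → k < m → iterate P y (suc k) ≡ y → ∃[ n ] MinimalPeriod y n) →
             iterate P y (suc m) ≡ y → ∃[ n ] MinimalPeriod y n
    search m shorter e with anyUpTo? (λ k → iterate P y (suc k) ≟ y) m
    ... | yes (k , k<m , e′) = shorter k<m e′
    ... | no none            = m , e , λ k<m e′ → none (_ , k<m , e′)

  orbit-steps : ∀ n y → Steps _≟_ P (applyUpTo (iterate P y) n)
  orbit-steps zero          y = tt
  orbit-steps (suc zero)    y = tt
  orbit-steps (suc (suc n)) y = refl , orbit-steps (suc n) (P y)

  orbit-last : ∀ n y → last _≟_ y (applyUpTo (iterate P (P y)) n) ≡ iterate P y n
  orbit-last zero    y = refl
  orbit-last (suc n) y = orbit-last n (P y)

  cycle-through : ∀ {y} → y ∈ D → ∃[ r ] IsCycle _≟_ D P (y ∷ r)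
  cycle-through {y} y∈D with uncurry minimal-period (period y∈D)
  ... | n , e , minimal =
      applyUpTo (iterate P (P y)) n
    , Unique-applyUpTo⁺₁ (iterate P y) (suc n) distinct
    , applyUpTo⁺₁ (iterate P y) (suc n) (λ {k} _ → iterate-closed k y∈D)
    , orbit-steps (suc n) y
    , trans (cong P (orbit-last n y)) (trans (sym (iterate-suc y n)) e)
    where
    distinct : ∀ {i j} → i < j → j < suc n → iterate P y i ≢ iterate P y j
    distinct {i} i<j j≤n e′ with m≤n⇒∃[o]m+o≡n i<j
    ... | o , refl = minimal (≤-trans (s≤s (m≤n+m o i)) (≤-pred j≤n))
                       (sym (iterate-cancel i (suc o) y∈D (trans e′ (cong (iterate P y) (sym (+-suc i o))))))

-- Deletes θ x and x from the cycles of G, provided that x is fixed by G or directly follows θ x.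
cutPair : {A : Set} → DecidableEquality A → (θ G : A → A) → A → A → A
cutPair _≟_ θ G x y with G y ≟ θ x
... | yes _ = G x
... | no _  = G y

module Mirror {A : Set} (_≟_ : DecidableEquality A) (D : List A) (θ : A → A)
  (θ-closed : ∀ x → x ∈ D → θ x ∈ D)
  (θ-involutive : ∀ x → x ∈ D → θ (θ x) ≡ x) where

  θ-injective : ∀ x y → x ∈ D → y ∈ D → θ x ≡ θ y → x ≡ y
  θ-injective x y x∈D y∈D e = trans (sym (θ-involutive x x∈D)) (trans (cong θ e) (θ-involutive y y∈D))

  unique-map-θ : ∀ {xs} → All (_∈ D) xs → Unique xs → Unique (map θ xs)
  unique-map-θ {xs} xs⊆D xs! = map⁻ (subst Unique (sym θθxs≡xs) xs!)
    where
    θθxs≡xs : map θ (map θ xs) ≡ xs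
    θθxs≡xs = trans (sym (map-∘ xs)) (map-id-local (All.map (λ {x} → θ-involutive x) xs⊆D))

  inverted⇒injective : ∀ {P} → InvertedBy D θ P → ∀ x y → x ∈ D → y ∈ D → P x ≡ P y → x ≡ y
  inverted⇒injective {P} inverted x y x∈D y∈D e =
    θ-injective x y x∈D y∈D (trans (sym (inverted x x∈D)) (trans (cong (λ z → P (θ z)) e) (inverted y y∈D)))

  module _ {P : A → A} (inverted : InvertedBy D θ P) where
    open Walks _≟_ P

    steps-reverseAcc : ∀ x xs acc → All (_∈ D) (x ∷ xs) → Steps _≟_ P (x ∷ xs) →
      Steps _≟_ P (map θ (x ∷ acc)) → Steps _≟_ P (map θ (reverseAcc (x ∷ acc) xs))
    steps-reverseAcc x []       acc _             _           mirrored = mirrored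
    steps-reverseAcc x (y ∷ xs) acc (x∈D ∷ xs⊆D) (Px≡y , st) mirrored =
      steps-reverseAcc y xs (x ∷ acc) xs⊆D st
        (trans (cong (λ z → P (θ z)) (sym Px≡y)) (inverted x x∈D) , mirrored)

    steps-mirror : ∀ xs → All (_∈ D) xs → Steps _≟_ P xs → Steps _≟_ P (map θ (reverse xs))
    steps-mirror []       _    _  = tt
    steps-mirror (x ∷ xs) xs⊆D st = steps-reverseAcc x xs [] xs⊆D st tt

    inverted⇒cyclesMirrored : CyclesMirrored _≟_ D θ P
    inverted⇒cyclesMirrored x r (x∷r! , x∷r⊆D , st , closed) =
        unique-map-θ x∷r̄⊆D (Unique-resp-↭ (setoid A) (↭⇒↭ₛ x∷r↭x∷r̄) x∷r!)
      , All-map⁺ (All.map (λ {z} → θ-closed z) x∷r̄⊆D)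
      , proj₁ mirrored-walk
      , proj₂ mirrored-walk
      where
      open ≡-Reasoning
      x∷r↭x∷r̄ : x ∷ r ↭ x ∷ reverse r
      x∷r↭x∷r̄ = ↭-prep x (↭-sym (↭-reverse r))
      x∷r̄⊆D : All (_∈ D) (x ∷ reverse r)
      x∷r̄⊆D = All-resp-↭ x∷r↭x∷r̄ x∷r⊆D
      reverse-walk : map θ (reverse (x ∷ r ∷ʳ x)) ≡ θ x ∷ map θ (reverse r) ∷ʳ θ x
      reverse-walk = begin
        map θ (reverse ((x ∷ r) ++ x ∷ []))  ≡⟨ cong (map θ) (reverse-++ (x ∷ r) (x ∷ [])) ⟩
        map θ (x ∷ reverse (x ∷ r))          ≡⟨ cong (λ zs → map θ (x ∷ zs)) (unfold-reverse x r) ⟩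
        θ x ∷ map θ (reverse r ++ x ∷ [])    ≡⟨ cong (θ x ∷_) (map-++ θ (reverse r) (x ∷ [])) ⟩
        θ x ∷ map θ (reverse r) ∷ʳ θ x       ∎
      mirrored-walk = steps-∷ʳ⁻ (θ x) (map θ (reverse r))
        (subst (Steps _≟_ P) reverse-walk
          (steps-mirror (x ∷ r ∷ʳ x) (∷ʳ⁺ x∷r⊆D (All.head x∷r⊆D)) (steps-∷ʳ⁺ x r st closed)))

  module _ {P : A → A} (P-closed : ∀ x → x ∈ D → P x ∈ D)
    (P-injective : ∀ x y → x ∈ D → y ∈ D → P x ≡ P y → x ≡ y) where
    open Orbits _≟_ D P P-closed P-injective
    open Walks _≟_ P

    cyclesMirrored⇒inverted : CyclesMirrored _≟_ D θ P → InvertedBy D θ P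
    cyclesMirrored⇒inverted mirrored y y∈D =
      let r , cycle = cycle-through y∈D in closing r cycle (mirrored y r cycle)
      where
      closing : ∀ r → IsCycle _≟_ D P (y ∷ r) → IsCycle _≟_ D P (θ y ∷ map θ (reverse r)) →
                P (θ (P y)) ≡ θ y
      closing []      (_ , _ , _ , Py≡y)        (_ , _ , _ , closed) =
        subst (λ z → P (θ z) ≡ θ y) (sym Py≡y) closed
      closing (z ∷ r) (_ , _ , (Py≡z , _) , _) (_ , _ , _ , closed) =
        subst (λ w → P (θ w) ≡ θ y) (sym Py≡z)
          (subst (λ w → P w ≡ θ y) last-mirror closed)
        where
        last-mirror : last _≟_ (θ y) (map θ (reverse (z ∷ r))) ≡ θ z
        last-mirror = trans (cong (λ zs → last _≟_ (θ y) (map θ zs)) (unfold-reverse z r))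
          (trans (cong (last _≟_ (θ y)) (map-++ θ (reverse r) (z ∷ [])))
                 (last-∷ʳ (θ y) (map θ (reverse r)) (θ z)))

  module CutPair {G : A → A} (G-closed : ∀ y → y ∈ D → G y ∈ D) (G-inverted : InvertedBy D θ G)
              {x : A} (x∈D : x ∈ D) where

    cut : A → A
    cut = cutPair _≟_ θ G x

    cut-hit : ∀ {y} → G y ≡ θ x → cut y ≡ G x
    cut-hit {y} Gy≡θx with G y ≟ θ x
    ... | yes _     = refl
    ... | no Gy≢θx = ⊥-elim (Gy≢θx Gy≡θx)

    cut-miss : ∀ {y} → G y ≢ θ x → cut y ≡ G y
    cut-miss {y} Gy≢θx with G y ≟ θ x
    ... | yes Gy≡θx = ⊥-elim (Gy≢θx Gy≡θx)
    ... | no _      = refl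

    cut-closed : ∀ y → y ∈ D → cut y ∈ D
    cut-closed y y∈D with G y ≟ θ x
    ... | yes _ = G-closed x x∈D
    ... | no _  = G-closed y y∈D

    private
      G-injective : ∀ u v → u ∈ D → v ∈ D → G u ≡ G v → u ≡ v
      G-injective = inverted⇒injective G-inverted
      θx∈D : θ x ∈ D
      θx∈D = θ-closed x x∈D

    cut-inverted : ∀ y → y ∈ D → y ≢ x → cut (θ (cut y)) ≡ θ y
    cut-inverted y y∈D y≢x with G y ≟ θ x
    ... | yes Gy≡θx = trans (cut-hit (G-inverted x x∈D))
      (trans (sym (θ-involutive _ (G-closed x x∈D))) (cong θ (sym y≡θGx)))
      where
      y≡θGx : y ≡ θ (G x)
      y≡θGx = G-injective _ _ y∈D (θ-closed _ (G-closed x x∈D)) (trans Gy≡θx (sym (G-inverted x x∈D)))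
    ... | no Gy≢θx = trans (cut-miss (λ e → y≢x (θ-injective _ _ y∈D x∈D (trans (sym (G-inverted y y∈D)) e))))
                           (G-inverted y y∈D)

    cut-avoids : G x ≡ x ⊎ G (θ x) ≡ x → ∀ y → y ∈ D → y ≢ x → y ≢ θ x → cut y ≢ x × cut y ≢ θ x
    cut-avoids x-fixed-or-next y y∈D y≢x y≢θx with G y ≟ θ x
    ... | yes Gy≡θx =
        (λ Gx≡x → y≢θx (G-injective _ _ y∈D θx∈D
           (trans Gy≡θx (sym (subst (λ z → G (θ z) ≡ θ x) Gx≡x (G-inverted x x∈D))))))
      , (λ Gx≡θx → y≢x (G-injective _ _ y∈D x∈D (trans Gy≡θx (sym Gx≡θx))))
    ... | no Gy≢θx = [ (λ Gx≡x Gy≡x → y≢x (G-injective _ _ y∈D x∈D (trans Gy≡x (sym Gx≡x))))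
                     , (λ Gθx≡x Gy≡x → y≢θx (G-injective _ _ y∈D θx∈D (trans Gy≡x (sym Gθx≡x)))) ]
                       x-fixed-or-next
                   , Gy≢θx

module Elementary {A : Set} (_≟_ : DecidableEquality A) where

  del-fixed : ∀ {Q : A → A} {x} → Q x ≡ x → ∀ y → del _≟_ Q x y ≡ Q y
  del-fixed {Q} {x} Qx≡x y with y ≟ x | Q y ≟ x
  ... | yes refl | _        = sym Qx≡x
  ... | no _     | yes Qy≡x = trans Qx≡x (sym Qy≡x)
  ... | no _     | no _     = refl

  preimage-spec : ∀ (f : A → A) L t {u} → u ∈ L → f u ≡ t →
                  f (preimage _≟_ f L t) ≡ t × preimage _≟_ f L t ∈ L
  preimage-spec f (y ∷ L) t u∈L fu≡t with f y ≟ t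
  ... | yes fy≡t = fy≡t , here refl
  preimage-spec f (y ∷ L) t (here refl) fu≡t | no fy≢t = ⊥-elim (fy≢t fu≡t)
  preimage-spec f (y ∷ L) t (there u∈L) fu≡t | no _ =
    let fc≡t , c∈L = preimage-spec f L t u∈L fu≡t in fc≡t , there c∈L

  swap-fst : ∀ x y → swap _≟_ x y x ≡ y
  swap-fst x y with x ≟ x
  ... | yes _ = refl
  ... | no x≢x = ⊥-elim (x≢x refl)

  swap-snd : ∀ x y → swap _≟_ x y y ≡ x
  swap-snd x y with y ≟ x | y ≟ y
  ... | yes y≡x | _      = y≡x
  ... | no _    | yes _  = refl
  ... | no _    | no y≢y = ⊥-elim (y≢y refl)

  swap-other : ∀ {x y z} → z ≢ x → z ≢ y → swap _≟_ x y z ≡ z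
  swap-other {x} {y} {z} z≢x z≢y with z ≟ x | z ≟ y
  ... | yes z≡x | _       = ⊥-elim (z≢x z≡x)
  ... | no _    | yes z≡y = ⊥-elim (z≢y z≡y)
  ... | no _    | no _    = refl

  swap-involutive : ∀ x y z → swap _≟_ x y (swap _≟_ x y z) ≡ z
  swap-involutive x y z with z ≟ x | z ≟ y
  ... | yes refl | _        = swap-snd z y
  ... | no _     | yes refl = swap-fst x z
  ... | no z≢x   | no z≢y   = swap-other z≢x z≢y

  swap-closed : ∀ {D : List A} {x y} → x ∈ D → y ∈ D → ∀ z → z ∈ D → swap _≟_ x y z ∈ D
  swap-closed {x = x} {y} x∈D y∈D z z∈D with z ≟ x | z ≟ y
  ... | yes _ | _     = y∈D
  ... | no _  | yes _ = x∈D
  ... | no _  | no _  = z∈D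

  cyc3-fst : ∀ x y z → cyc3 _≟_ x y z x ≡ y
  cyc3-fst x y z with x ≟ x
  ... | yes _   = refl
  ... | no x≢x = ⊥-elim (x≢x refl)

  cyc3-snd : ∀ {x y} z → y ≢ x → cyc3 _≟_ x y z y ≡ z
  cyc3-snd {x} {y} z y≢x with y ≟ x | y ≟ y
  ... | yes y≡x | _      = ⊥-elim (y≢x y≡x)
  ... | no _    | yes _  = refl
  ... | no _    | no y≢y = ⊥-elim (y≢y refl)

  cyc3-thd : ∀ {x y z} → z ≢ x → z ≢ y → cyc3 _≟_ x y z z ≡ x
  cyc3-thd {x} {y} {z} z≢x z≢y with z ≟ x | z ≟ y | z ≟ z
  ... | yes z≡x | _       | _      = ⊥-elim (z≢x z≡x)
  ... | no _    | yes z≡y | _      = ⊥-elim (z≢y z≡y)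
  ... | no _    | no _    | yes _  = refl
  ... | no _    | no _    | no z≢z = ⊥-elim (z≢z refl)

  cyc3-other : ∀ {x y z w} → w ≢ x → w ≢ y → w ≢ z → cyc3 _≟_ x y z w ≡ w
  cyc3-other {x} {y} {z} {w} w≢x w≢y w≢z with w ≟ x | w ≟ y | w ≟ z
  ... | yes w≡x | _       | _       = ⊥-elim (w≢x w≡x)
  ... | no _    | yes w≡y | _       = ⊥-elim (w≢y w≡y)
  ... | no _    | no _    | yes w≡z = ⊥-elim (w≢z w≡z)
  ... | no _    | no _    | no _    = refl

  cyc3-inverse : ∀ {x y z} → y ≢ x → z ≢ x → z ≢ y → ∀ w → cyc3 _≟_ x z y (cyc3 _≟_ x y z w) ≡ w
  cyc3-inverse {x} {y} {z} y≢x z≢x z≢y w with x ≟ w | y ≟ w | z ≟ w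
  ... | yes refl | _        | _        = trans (cong (cyc3 _≟_ x z y) (cyc3-fst x y z))
                                              (cyc3-thd y≢x (λ y≡z → z≢y (sym y≡z)))
  ... | no _     | yes refl | _        = trans (cong (cyc3 _≟_ x z y) (cyc3-snd z y≢x)) (cyc3-snd y z≢x)
  ... | no _     | no _     | yes refl = trans (cong (cyc3 _≟_ x z y) (cyc3-thd z≢x z≢y)) (cyc3-fst x z y)
  ... | no x≢w   | no y≢w   | no z≢w   =
    trans (cong (cyc3 _≟_ x z y) (cyc3-other (≢-sym x≢w) (≢-sym y≢w) (≢-sym z≢w)))
          (cyc3-other (≢-sym x≢w) (≢-sym z≢w) (≢-sym y≢w))

  cyc3-closed : ∀ {D : List A} {x y z} → x ∈ D → y ∈ D → z ∈ D → ∀ w → w ∈ D → cyc3 _≟_ x y z w ∈ D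
  cyc3-closed {x = x} {y} {z} x∈D y∈D z∈D w w∈D with w ≟ x | w ≟ y | w ≟ z
  ... | yes _ | _     | _     = y∈D
  ... | no _  | yes _ | _     = z∈D
  ... | no _  | no _  | yes _ = x∈D
  ... | no _  | no _  | no _  = w∈D

module Reduction {A : Set} (_≟_ : DecidableEquality A) (S : List A) (θ P : A → A) (a b : A)
  (S! : Unique S) (θS-disjoint : ∀ x → x ∈ S → θ x ∉ S)
  (θ-involutive : ∀ x → x ∈ ground _≟_ θ S → θ (θ x) ≡ x)
  (P-closed : ∀ x → x ∈ ground _≟_ θ S → P x ∈ ground _≟_ θ S)
  (P-injective : ∀ x y → x ∈ ground _≟_ θ S → y ∈ ground _≟_ θ S → P x ≡ P y → x ≡ y)
  (P-mirrored : CyclesMirrored _≟_ (ground _≟_ θ S) θ P)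
  (a∈S : a ∈ S) (b∈S : b ∈ S) (a≢b : a ≢ b) where
  open Elementary _≟_

  D S′ D′ : List A
  D  = ground _≟_ θ S
  S′ = remove _≟_ b S
  D′ = ground _≟_ θ S′

  ≢b? : ∀ z → Dec (z ≢ b)
  ≢b? z = ¬? (z ≟ b)

  θ-closed : ∀ x → x ∈ D → θ x ∈ D
  θ-closed x x∈D with ∈-++⁻ S x∈D
  ... | inj₁ x∈S  = ∈-++⁺ʳ S (∈-map⁺ θ x∈S)
  ... | inj₂ x∈θS with ∈-map⁻ θ x∈θS
  ...   | s , s∈S , refl = subst (_∈ D) (sym (θ-involutive s (∈-++⁺ˡ s∈S))) (∈-++⁺ˡ s∈S)

  open Mirror _≟_ D θ θ-closed θ-involutive

  P-inverted : InvertedBy D θ P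
  P-inverted = cyclesMirrored⇒inverted P-closed P-injective P-mirrored

  S≢θS : ∀ {x y} → x ∈ S → y ∈ S → x ≢ θ y
  S≢θS x∈S y∈S x≡θy = θS-disjoint _ y∈S (subst (_∈ S) x≡θy x∈S)

  a∈D : a ∈ D
  a∈D = ∈-++⁺ˡ a∈S
  b∈D : b ∈ D
  b∈D = ∈-++⁺ˡ b∈S
  θa∈D : θ a ∈ D
  θa∈D = θ-closed a a∈D
  θb∈D : θ b ∈ D
  θb∈D = θ-closed b b∈D
  θb≢b : θ b ≢ b
  θb≢b = ≢-sym (S≢θS b∈S b∈S)
  θb≢a : θ b ≢ a
  θb≢a = ≢-sym (S≢θS a∈S b∈S)
  θa≢θb : θ a ≢ θ b
  θa≢θb e = a≢b (θ-injective a b a∈D b∈D e)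

  ≢θ⇒θ≢ : ∀ {y x} → y ∈ D → y ≢ θ x → θ y ≢ x
  ≢θ⇒θ≢ {y} y∈D y≢θx θy≡x = y≢θx (trans (sym (θ-involutive y y∈D)) (cong θ θy≡x))

  ∈D′⁺ : ∀ {y} → y ∈ D → y ≢ b → y ≢ θ b → y ∈ D′
  ∈D′⁺ {y} y∈D y≢b y≢θb with ∈-++⁻ S y∈D
  ... | inj₁ y∈S  = ∈-++⁺ˡ (∈-filter⁺ ≢b? y∈S y≢b)
  ... | inj₂ y∈θS with ∈-map⁻ θ y∈θS
  ...   | s , s∈S , refl = ∈-++⁺ʳ S′ (∈-map⁺ θ (∈-filter⁺ ≢b? s∈S (λ s≡b → y≢θb (cong θ s≡b))))

  ∈D′⁻ : ∀ {y} → y ∈ D′ → y ∈ D × y ≢ b × y ≢ θ b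
  ∈D′⁻ {y} y∈D′ with ∈-++⁻ S′ y∈D′
  ... | inj₁ y∈S′ with ∈-filter⁻ ≢b? y∈S′
  ...   | y∈S , y≢b = ∈-++⁺ˡ y∈S , y≢b , S≢θS y∈S b∈S
  ∈D′⁻ {y} y∈D′ | inj₂ y∈θS′ with ∈-map⁻ θ y∈θS′
  ...   | s , s∈S′ , refl with ∈-filter⁻ ≢b? s∈S′
  ...     | s∈S , s≢b = ∈-++⁺ʳ S (∈-map⁺ θ s∈S) , ≢-sym (S≢θS b∈S s∈S)
                       , λ θs≡θb → s≢b (θ-injective s b (∈-++⁺ˡ s∈S) b∈D θs≡θb)

  D′-θ-closed : ∀ y → y ∈ D′ → θ y ∈ D′
  D′-θ-closed y y∈D′ =
    let y∈D , y≢b , y≢θb = ∈D′⁻ y∈D′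
    in ∈D′⁺ (θ-closed y y∈D) (≢θ⇒θ≢ y∈D y≢θb) (λ θy≡θb → y≢b (θ-injective y b y∈D b∈D θy≡θb))

  D′-θ-involutive : ∀ y → y ∈ D′ → θ (θ y) ≡ y
  D′-θ-involutive y y∈D′ = θ-involutive y (proj₁ (∈D′⁻ y∈D′))

  setup′ : Setup _≟_ S′ θ
  setup′ = filter⁺ ≢b? S!
         , (λ x x∈S′ θx∈S′ → θS-disjoint x (proj₁ (∈-filter⁻ ≢b? x∈S′))
                                          (proj₁ (∈-filter⁻ ≢b? θx∈S′)))
         , D′-θ-involutive

  -- The factor (θa, θb, c) of P_{a,θa}, where c = θb P_a⁻¹, including its degenerate cases.
  θcycle : A → A → A
  θcycle c y with c ≟ θ b | θ a ≟ c
  ... | yes _ | _     = y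
  ... | no _  | yes _ = swap _≟_ (θ b) (θ a) y
  ... | no _  | no _  = cyc3 _≟_ (θ a) (θ b) c y

  Paθa-unfold : ∀ y → Paθa _≟_ S θ P a b y
    ≡ del _≟_ (λ z → Pa _≟_ P a b (θcycle (preimage _≟_ (Pa _≟_ P a b) (remove _≟_ b D) (θ b)) z)) (θ b) y
  Paθa-unfold y with preimage _≟_ (Pa _≟_ P a b) (remove _≟_ b D) (θ b)
  ... | c with c ≟ θ b | θ a ≟ c
  ...   | yes _ | _     = refl
  ...   | no _  | yes _ = refl
  ...   | no _  | no _  = refl

  θcycle-θb : ∀ c → θcycle c (θ b) ≡ c
  θcycle-θb c with c ≟ θ b | θ a ≟ c
  ... | yes c≡θb | _        = sym c≡θb
  ... | no _     | yes θa≡c = trans (swap-fst (θ b) (θ a)) θa≡c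
  ... | no _     | no _     = cyc3-snd c (≢-sym θa≢θb)

  θcycle-id : ∀ {c} → c ≡ θ b → ∀ y → θcycle c y ≡ y
  θcycle-id {c} c≡θb y with c ≟ θ b
  ... | yes _    = refl
  ... | no c≢θb = ⊥-elim (c≢θb c≡θb)

  θcycle-swap : ∀ {c} → c ≡ θ a → ∀ y → θcycle c y ≡ swap _≟_ (θ b) (θ a) y
  θcycle-swap {c} c≡θa y with c ≟ θ b | θ a ≟ c
  ... | yes c≡θb | _        = ⊥-elim (θa≢θb (trans (sym c≡θa) c≡θb))
  ... | no _     | yes _    = refl
  ... | no _     | no θa≢c = ⊥-elim (θa≢c (sym c≡θa))

  θcycle-cyc3 : ∀ {c} → c ≢ θ b → c ≢ θ a → ∀ y → θcycle c y ≡ cyc3 _≟_ (θ a) (θ b) c y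
  θcycle-cyc3 {c} c≢θb c≢θa y with c ≟ θ b | θ a ≟ c
  ... | yes c≡θb | _        = ⊥-elim (c≢θb c≡θb)
  ... | no _     | yes θa≡c = ⊥-elim (c≢θa (sym θa≡c))
  ... | no _     | no _     = refl

  θcycle-cases : ∀ c → c ≡ θ b ⊎ c ≡ θ a ⊎ (c ≢ θ b × c ≢ θ a)
  θcycle-cases c with c ≟ θ b | c ≟ θ a
  ... | yes c≡θb | _        = inj₁ c≡θb
  ... | no _     | yes c≡θa = inj₂ (inj₁ c≡θa)
  ... | no c≢θb  | no c≢θa  = inj₂ (inj₂ (c≢θb , c≢θa))

  Reduced : Set
  Reduced = (∀ y → y ∈ D′ → Paθa _≟_ S θ P a b y ∈ D′) × InvertedBy D′ θ (Paθa _≟_ S θ P a b)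

  -- P_a = P ρ / b, where ρ is 1, (b, a) or (b, a, bP) and satisfies b P ρ = b.
  module RightFactor (ρ ρ⁻¹ : A → A)
    (ρ-closed : ∀ x → x ∈ D → ρ x ∈ D) (ρ⁻¹-closed : ∀ x → x ∈ D → ρ⁻¹ x ∈ D)
    (ρ⁻¹-ρ : ∀ x → ρ⁻¹ (ρ x) ≡ x) (ρ-ρ⁻¹ : ∀ x → ρ (ρ⁻¹ x) ≡ x)
    (ρ-fixes-b : ρ (P b) ≡ b)
    (Pa-unfold : ∀ y → Pa _≟_ P a b y ≡ del _≟_ (λ z → ρ (P z)) b y) where

    Q : A → A
    Q y = ρ (P y)

    Pa≗Q : ∀ y → Pa _≟_ P a b y ≡ Q y
    Pa≗Q y = trans (Pa-unfold y) (del-fixed ρ-fixes-b y)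

    Q-closed : ∀ y → y ∈ D → Q y ∈ D
    Q-closed y y∈D = ρ-closed _ (P-closed y y∈D)

    Q-injective : ∀ u v → u ∈ D → v ∈ D → Q u ≡ Q v → u ≡ v
    Q-injective u v u∈D v∈D Qu≡Qv =
      P-injective u v u∈D v∈D (trans (sym (ρ⁻¹-ρ (P u))) (trans (cong ρ⁻¹ Qu≡Qv) (ρ⁻¹-ρ (P v))))

    σ : A → A
    σ y = θ (ρ⁻¹ (θ y))

    σ-θ : ∀ {x} → x ∈ D → σ (θ x) ≡ θ (ρ⁻¹ x)
    σ-θ {x} x∈D = cong (λ z → θ (ρ⁻¹ z)) (θ-involutive x x∈D)

    σ-fixed : ∀ {y} → y ∈ D → ρ⁻¹ (θ y) ≡ θ y → σ y ≡ y
    σ-fixed {y} y∈D e = trans (cong θ e) (θ-involutive y y∈D)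

    σ-closed : ∀ y → y ∈ D → σ y ∈ D
    σ-closed y y∈D = θ-closed _ (ρ⁻¹-closed _ (θ-closed y y∈D))

    -- In the right-action notation G = θ ρ⁻¹ θ P ρ, so θ G θ = ρ⁻¹ P⁻¹ θ ρ θ = G⁻¹.
    G : A → A
    G y = Q (σ y)

    G-closed : ∀ y → y ∈ D → G y ∈ D
    G-closed y y∈D = Q-closed _ (σ-closed y y∈D)

    G-inverted : InvertedBy D θ G
    G-inverted y y∈D = begin
      ρ (P (θ (ρ⁻¹ (θ (θ (ρ (P (σ y))))))))  ≡⟨ cong (λ z → ρ (P (θ (ρ⁻¹ z)))) (θ-involutive _ (G-closed y y∈D)) ⟩
      ρ (P (θ (ρ⁻¹ (ρ (P (σ y))))))          ≡⟨ cong (λ z → ρ (P (θ z))) (ρ⁻¹-ρ _) ⟩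
      ρ (P (θ (P (σ y))))                    ≡⟨ cong ρ (P-inverted _ (σ-closed y y∈D)) ⟩
      ρ (θ (θ (ρ⁻¹ (θ y))))                  ≡⟨ cong ρ (θ-involutive _ (ρ⁻¹-closed _ (θ-closed y y∈D))) ⟩
      ρ (ρ⁻¹ (θ y))                          ≡⟨ ρ-ρ⁻¹ (θ y) ⟩
      θ y                                    ∎
      where open ≡-Reasoning

    open CutPair G-closed G-inverted b∈D

    c : A
    c = preimage _≟_ (Pa _≟_ P a b) (remove _≟_ b D) (θ b)

    c-spec : Q c ≡ θ b × c ∈ D × c ≢ b
    c-spec =
      let Pac≡θb , c∈D-b = preimage-spec (Pa _≟_ P a b) (remove _≟_ b D) (θ b)
                             (∈-filter⁺ ≢b? u∈D u≢b) (trans (Pa≗Q u) Qu≡θb)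
          c∈D , c≢b = ∈-filter⁻ ≢b? {xs = D} c∈D-b
      in trans (sym (Pa≗Q c)) Pac≡θb , c∈D , c≢b
      where
      u : A
      u = σ (θ (G b))
      u∈D : u ∈ D
      u∈D = σ-closed _ (θ-closed _ (G-closed b b∈D))
      Qu≡θb : Q u ≡ θ b
      Qu≡θb = G-inverted b b∈D
      u≢b : u ≢ b
      u≢b u≡b = θb≢b (trans (sym Qu≡θb) (trans (cong Q u≡b) ρ-fixes-b))

    R≗Qθcycle : ∀ y → Paθa _≟_ S θ P a b y ≡ Q (θcycle c y)
    R≗Qθcycle y = trans (Paθa-unfold y) (trans (del-fixed Pa-θb y) (Pa≗Q (θcycle c y)))
      where
      Pa-θb : Pa _≟_ P a b (θcycle c (θ b)) ≡ θ b
      Pa-θb = trans (cong (Pa _≟_ P a b) (θcycle-θb c)) (trans (Pa≗Q c) (proj₁ c-spec))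

    -- Paθa y = Q (θcycle c y), whereas cut y = Q (σ y), or Q (σ b) when G y = θ b, i.e. when σ y = c.
    AgreesAt : A → Set
    AgreesAt y = (σ y ≢ c × θcycle c y ≡ σ y) ⊎ (σ y ≡ c × θcycle c y ≡ σ b)

    agreement⇒reduced : G b ≡ b ⊎ G (θ b) ≡ b → (∀ y → y ∈ D′ → AgreesAt y) → Reduced
    agreement⇒reduced b-fixed-or-next agrees = R-closed , R-inverted
      where
      R : A → A
      R = Paθa _≟_ S θ P a b
      R≗cut : ∀ y → y ∈ D′ → R y ≡ cut y
      R≗cut y y∈D′ with agrees y y∈D′
      ... | inj₁ (σy≢c , θcycle≡σy) = trans (R≗Qθcycle y) (trans (cong Q θcycle≡σy) (sym (cut-miss Gy≢θb)))
        where
        Gy≢θb : G y ≢ θ b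
        Gy≢θb Gy≡θb = σy≢c (Q-injective _ _ (σ-closed y (proj₁ (∈D′⁻ y∈D′))) (proj₁ (proj₂ c-spec))
                              (trans Gy≡θb (sym (proj₁ c-spec))))
      ... | inj₂ (σy≡c , θcycle≡σb) =
        trans (R≗Qθcycle y) (trans (cong Q θcycle≡σb) (sym (cut-hit (trans (cong Q σy≡c) (proj₁ c-spec)))))
      cut-closed′ : ∀ y → y ∈ D′ → cut y ∈ D′
      cut-closed′ y y∈D′ =
        let y∈D , y≢b , y≢θb = ∈D′⁻ y∈D′
            cut≢b , cut≢θb = cut-avoids b-fixed-or-next y y∈D y≢b y≢θb
        in ∈D′⁺ (cut-closed y y∈D) cut≢b cut≢θb
      R-closed : ∀ y → y ∈ D′ → R y ∈ D′
      R-closed y y∈D′ = subst (_∈ D′) (sym (R≗cut y y∈D′)) (cut-closed′ y y∈D′)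
      R-inverted : InvertedBy D′ θ R
      R-inverted y y∈D′ = begin
        R (θ (R y))       ≡⟨ cong (λ z → R (θ z)) (R≗cut y y∈D′) ⟩
        R (θ (cut y))    ≡⟨ R≗cut _ (D′-θ-closed _ (cut-closed′ y y∈D′)) ⟩
        cut (θ (cut y)) ≡⟨ cut-inverted y (proj₁ (∈D′⁻ y∈D′)) (proj₁ (proj₂ (∈D′⁻ y∈D′))) ⟩
        θ y               ∎
        where open ≡-Reasoning

  module FixedCase (Pb≡b : P b ≡ b) where

    Pa-unfold : ∀ y → Pa _≟_ P a b y ≡ del _≟_ (λ z → P z) b y
    Pa-unfold y with P b ≟ b
    ... | yes _    = refl
    ... | no Pb≢b = ⊥-elim (Pb≢b Pb≡b)

    open RightFactor (λ x → x) (λ x → x) (λ _ x∈D → x∈D) (λ _ x∈D → x∈D) (λ _ → refl) (λ _ → refl)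
                    Pb≡b Pa-unfold

    c≡θb : c ≡ θ b
    c≡θb = Q-injective _ _ (proj₁ (proj₂ c-spec)) θb∈D
             (trans (proj₁ c-spec) (sym (subst (λ z → P (θ z) ≡ θ b) Pb≡b (P-inverted b b∈D))))

    agrees : ∀ y → y ∈ D′ → AgreesAt y
    agrees y y∈D′ =
      let y∈D , _ , y≢θb = ∈D′⁻ y∈D′
          σy≡y = σ-fixed y∈D refl
      in inj₁ ((λ σy≡c → y≢θb (trans (sym σy≡y) (trans σy≡c c≡θb)))
              , trans (θcycle-id c≡θb y) (sym σy≡y))

    reduced : Reduced
    reduced = agreement⇒reduced (inj₁ (trans (cong P (θ-involutive b b∈D)) Pb≡b)) agrees

  module SwapCase (Pb≢b : P b ≢ b) (a≡Pb : a ≡ P b) where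

    Pa-unfold : ∀ y → Pa _≟_ P a b y ≡ del _≟_ (λ z → swap _≟_ b a (P z)) b y
    Pa-unfold y with P b ≟ b | a ≟ P b
    ... | yes Pb≡b | _        = ⊥-elim (Pb≢b Pb≡b)
    ... | no _     | yes _    = refl
    ... | no _     | no a≢Pb = ⊥-elim (a≢Pb a≡Pb)

    swap-closed-ba : ∀ x → x ∈ D → swap _≟_ b a x ∈ D
    swap-closed-ba = swap-closed b∈D a∈D

    b-fixed : swap _≟_ b a (P b) ≡ b
    b-fixed = trans (cong (swap _≟_ b a) (sym a≡Pb)) (swap-snd b a)

    open RightFactor (swap _≟_ b a) (swap _≟_ b a) swap-closed-ba swap-closed-ba
                    (swap-involutive b a) (swap-involutive b a) b-fixed Pa-unfold

    σb≡b : σ b ≡ b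
    σb≡b = σ-fixed b∈D (swap-other θb≢b θb≢a)

    c≡θa : c ≡ θ a
    c≡θa = Q-injective _ _ (proj₁ (proj₂ c-spec)) θa∈D (trans (proj₁ c-spec) (sym Qθa≡θb))
      where
      Qθa≡θb : Q (θ a) ≡ θ b
      Qθa≡θb = trans (cong (swap _≟_ b a) (subst (λ z → P (θ z) ≡ θ b) (sym a≡Pb) (P-inverted b b∈D)))
                     (swap-other θb≢b θb≢a)

    agrees : ∀ y → y ∈ D′ → AgreesAt y
    agrees y y∈D′ with ∈D′⁻ y∈D′ | y ≟ θ a
    ... | _ | yes refl =
      inj₁ ((λ σθa≡c → θa≢θb (trans (sym c≡θa) (trans (sym σθa≡c) σθa≡θb)))
           , trans (θcycle-swap c≡θa (θ a)) (trans (swap-snd (θ b) (θ a)) (sym σθa≡θb)))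
      where
      σθa≡θb : σ (θ a) ≡ θ b
      σθa≡θb = trans (σ-θ a∈D) (cong θ (swap-snd b a))
    ... | y∈D , _ , y≢θb | no y≢θa =
      let σy≡y = σ-fixed y∈D (swap-other (≢θ⇒θ≢ y∈D y≢θb) (≢θ⇒θ≢ y∈D y≢θa))
      in inj₁ ((λ σy≡c → y≢θa (trans (sym σy≡y) (trans σy≡c c≡θa)))
              , trans (θcycle-swap c≡θa y) (trans (swap-other y≢θb y≢θa) (sym σy≡y)))

    reduced : Reduced
    reduced = agreement⇒reduced (inj₁ (trans (cong Q σb≡b) b-fixed)) agrees

  module ThreeCycleCase (Pb≢b : P b ≢ b) (a≢Pb : a ≢ P b) where

    p : A
    p = P b

    p∈D : p ∈ D
    p∈D = P-closed b b∈D

    Pa-unfold : ∀ y → Pa _≟_ P a b y ≡ del _≟_ (λ z → cyc3 _≟_ b a p (P z)) b y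
    Pa-unfold y with P b ≟ b | a ≟ P b
    ... | yes Pb≡b | _        = ⊥-elim (Pb≢b Pb≡b)
    ... | no _     | yes a≡Pb = ⊥-elim (a≢Pb a≡Pb)
    ... | no _     | no _     = refl

    b-fixed : cyc3 _≟_ b a p p ≡ b
    b-fixed = cyc3-thd Pb≢b (≢-sym a≢Pb)

    open RightFactor (cyc3 _≟_ b a p) (cyc3 _≟_ b p a)
                    (cyc3-closed b∈D a∈D p∈D) (cyc3-closed b∈D p∈D a∈D)
                    (cyc3-inverse a≢b Pb≢b (≢-sym a≢Pb)) (cyc3-inverse Pb≢b a≢b a≢Pb)
                    b-fixed Pa-unfold

    σθa≡θb : σ (θ a) ≡ θ b
    σθa≡θb = trans (σ-θ a∈D) (cong θ (cyc3-thd a≢b a≢Pb))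

    σ-other : ∀ {y} → y ∈ D → y ≢ θ b → y ≢ θ p → y ≢ θ a → σ y ≡ y
    σ-other y∈D y≢θb y≢θp y≢θa = σ-fixed y∈D (cyc3-other (≢θ⇒θ≢ y∈D y≢θb) (≢θ⇒θ≢ y∈D y≢θp) (≢θ⇒θ≢ y∈D y≢θa))

    module Apart (Pb≢θb : P b ≢ θ b) where

      θp∈D : θ p ∈ D
      θp∈D = θ-closed p p∈D

      θp≢θb : θ p ≢ θ b
      θp≢θb θp≡θb = Pb≢b (θ-injective p b p∈D b∈D θp≡θb)

      θp≢θa : θ p ≢ θ a
      θp≢θa θp≡θa = a≢Pb (θ-injective a p a∈D p∈D (sym θp≡θa))

      c≡θp : c ≡ θ p
      c≡θp = Q-injective _ _ (proj₁ (proj₂ c-spec)) θp∈D (trans (proj₁ c-spec) (sym Qθp≡θb))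
        where
        Qθp≡θb : Q (θ p) ≡ θ b
        Qθp≡θb = trans (cong (cyc3 _≟_ b a p) (P-inverted b b∈D))
                       (cyc3-other θb≢b θb≢a (≢-sym Pb≢θb))

      θcycle≗cyc3 : ∀ y → θcycle c y ≡ cyc3 _≟_ (θ a) (θ b) (θ p) y
      θcycle≗cyc3 y = trans (θcycle-cyc3 (λ c≡θb → θp≢θb (trans (sym c≡θp) c≡θb))
                                     (λ c≡θa → θp≢θa (trans (sym c≡θp) c≡θa)) y)
                          (cong (λ z → cyc3 _≟_ (θ a) (θ b) z y) c≡θp)

      agrees : ∀ y → y ∈ D′ → AgreesAt y
      agrees y y∈D′ with ∈D′⁻ y∈D′ | y ≟ θ a | y ≟ θ p
      ... | _ | yes refl | _ =
        inj₁ ((λ σy≡c → θp≢θb (trans (sym c≡θp) (trans (sym σy≡c) σθa≡θb)))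
             , trans (θcycle≗cyc3 (θ a)) (trans (cyc3-fst (θ a) (θ b) (θ p)) (sym σθa≡θb)))
      ... | _ | no _ | yes refl =
        inj₁ ((λ σy≡c → θp≢θa (trans (sym c≡θp) (trans (sym σy≡c) σθp≡θa)))
             , trans (θcycle≗cyc3 (θ p)) (trans (cyc3-thd θp≢θa θp≢θb) (sym σθp≡θa)))
        where
        σθp≡θa : σ (θ p) ≡ θ a
        σθp≡θa = trans (σ-θ p∈D) (cong θ (cyc3-snd a Pb≢b))
      ... | y∈D , _ , y≢θb | no y≢θa | no y≢θp =
        let σy≡y = σ-other y∈D y≢θb y≢θp y≢θa
        in inj₁ ((λ σy≡c → y≢θp (trans (sym σy≡y) (trans σy≡c c≡θp)))
                , trans (θcycle≗cyc3 y) (trans (cyc3-other y≢θa y≢θb y≢θp) (sym σy≡y)))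

      σb≡b : σ b ≡ b
      σb≡b = σ-fixed b∈D (cyc3-other θb≢b (≢-sym Pb≢θb) θb≢a)

      reduced : Reduced
      reduced = agreement⇒reduced (inj₁ (trans (cong Q σb≡b) b-fixed)) agrees

    module Adjacent (Pb≡θb : P b ≡ θ b) where

      θp≡b : θ p ≡ b
      θp≡b = trans (cong θ Pb≡θb) (θ-involutive b b∈D)

      σθb≡b : σ (θ b) ≡ b
      σθb≡b = trans (σ-θ b∈D) (trans (cong θ (cyc3-fst b p a)) θp≡b)

      σb≡θa : σ b ≡ θ a
      σb≡θa = trans (cong (λ z → θ (cyc3 _≟_ b p a z)) (sym Pb≡θb)) (cong θ (cyc3-snd a Pb≢b))

      σ-other′ : ∀ {y} → y ∈ D′ → y ≢ θ a → σ y ≡ y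
      σ-other′ y∈D′ y≢θa =
        let y∈D , y≢b , y≢θb = ∈D′⁻ y∈D′
        in σ-other y∈D y≢θb (λ y≡θp → y≢b (trans y≡θp θp≡b)) y≢θa

      agrees : ∀ y → y ∈ D′ → AgreesAt y
      agrees y y∈D′ with θcycle-cases c | y ≟ θ a
      ... | inj₁ c≡θb | yes refl =
        inj₂ (trans σθa≡θb (sym c≡θb) , trans (θcycle-id c≡θb (θ a)) (sym σb≡θa))
      ... | inj₁ c≡θb | no y≢θa =
        let σy≡y = σ-other′ y∈D′ y≢θa
        in inj₁ ((λ σy≡c → proj₂ (proj₂ (∈D′⁻ y∈D′)) (trans (sym σy≡y) (trans σy≡c c≡θb)))
                , trans (θcycle-id c≡θb y) (sym σy≡y))
      ... | inj₂ (inj₁ c≡θa) | yes refl =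
        inj₁ ((λ σy≡c → θa≢θb (trans (sym c≡θa) (trans (sym σy≡c) σθa≡θb)))
             , trans (θcycle-swap c≡θa (θ a)) (trans (swap-snd (θ b) (θ a)) (sym σθa≡θb)))
      ... | inj₂ (inj₁ c≡θa) | no y≢θa =
        let σy≡y = σ-other′ y∈D′ y≢θa
        in inj₁ ((λ σy≡c → y≢θa (trans (sym σy≡y) (trans σy≡c c≡θa)))
                , trans (θcycle-swap c≡θa y)
                        (trans (swap-other (proj₂ (proj₂ (∈D′⁻ y∈D′))) y≢θa) (sym σy≡y)))
      ... | inj₂ (inj₂ (c≢θb , c≢θa)) | yes refl =
        inj₁ ((λ σy≡c → c≢θb (trans (sym σy≡c) σθa≡θb))
             , trans (θcycle-cyc3 c≢θb c≢θa (θ a)) (trans (cyc3-fst (θ a) (θ b) c) (sym σθa≡θb)))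
      ... | inj₂ (inj₂ (c≢θb , c≢θa)) | no y≢θa with y ≟ c
      ...   | yes refl =
        inj₂ (σ-other′ y∈D′ y≢θa
             , trans (θcycle-cyc3 c≢θb c≢θa y) (trans (cyc3-thd c≢θa c≢θb) (sym σb≡θa)))
      ...   | no y≢c =
        let σy≡y = σ-other′ y∈D′ y≢θa
        in inj₁ ((λ σy≡c → y≢c (trans (sym σy≡y) σy≡c))
                , trans (θcycle-cyc3 c≢θb c≢θa y)
                        (trans (cyc3-other y≢θa (proj₂ (proj₂ (∈D′⁻ y∈D′))) y≢c) (sym σy≡y)))

      reduced : Reduced
      reduced = agreement⇒reduced (inj₂ (trans (cong Q σθb≡b) b-fixed)) agrees

  reduced : Reduced
  reduced = by-cases (P b ≟ b) (a ≟ P b) (P b ≟ θ b)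
    where
    by-cases : Dec (P b ≡ b) → Dec (a ≡ P b) → Dec (P b ≡ θ b) → Reduced
    by-cases (yes Pb≡b) _          _           = FixedCase.reduced Pb≡b
    by-cases (no Pb≢b)  (yes a≡Pb) _           = SwapCase.reduced Pb≢b a≡Pb
    by-cases (no Pb≢b)  (no a≢Pb)  (yes Pb≡θb) = ThreeCycleCase.Adjacent.reduced Pb≢b a≢Pb Pb≡θb
    by-cases (no Pb≢b)  (no a≢Pb)  (no Pb≢θb)  = ThreeCycleCase.Apart.reduced Pb≢b a≢Pb Pb≢θb

  private
    module On-D′ = Mirror _≟_ D′ θ D′-θ-closed D′-θ-involutive

  reduced-isPerm : IsPerm _≟_ D′ (Paθa _≟_ S θ P a b)
  reduced-isPerm = proj₁ reduced , On-D′.inverted⇒injective (proj₂ reduced)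

  reduced-cyclesMirrored : CyclesMirrored _≟_ D′ θ (Paθa _≟_ S θ P a b)
  reduced-cyclesMirrored = On-D′.inverted⇒cyclesMirrored (proj₂ reduced)

module _ {A : Set} (_≟_ : DecidableEquality A) (b : A) where

  private
    ≢b? : ∀ z → Dec (z ≢ b)
    ≢b? z = ¬? (z ≟ b)

  delPart-nonempty : ∀ Π → All (λ B → B ≢ []) (delPart _≟_ b Π)
  delPart-nonempty []      = []
  delPart-nonempty (B ∷ Π) with remove _≟_ b B
  ... | []    = delPart-nonempty Π
  ... | _ ∷ _ = (λ ()) ∷ delPart-nonempty Π

  concat-delPart : ∀ Π → concat (delPart _≟_ b Π) ≡ remove _≟_ b (concat Π)
  concat-delPart []      = refl
  concat-delPart (B ∷ Π) = trans (concat-consNE (remove _≟_ b B))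
    (trans (cong (remove _≟_ b B ++_) (concat-delPart Π)) (sym (filter-++ ≢b? B (concat Π))))
    where
    concat-consNE : ∀ B′ → concat (consNE _≟_ B′ (delPart _≟_ b Π)) ≡ B′ ++ concat (delPart _≟_ b Π)
    concat-consNE []      = refl
    concat-consNE (_ ∷ _) = refl

  delPart-partition : ∀ {S Π} → IsPartition _≟_ S Π → IsPartition _≟_ (remove _≟_ b S) (delPart _≟_ b Π)
  delPart-partition {S} {Π} (_ , Π↭S) =
    delPart-nonempty Π , subst (_↭ remove _≟_ b S) (sym (concat-delPart Π)) (filter-↭ ≢b? Π↭S)

mainTheorem1 : {A : Set} (_≟_ : DecidableEquality A)
    (S : List A) (θ P : A → A) (Π : List (List A)) (a b : A)
    → Setup _≟_ S θ
    → PBPair _≟_ S θ P Π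
    → a ∈ S → b ∈ S → a ≢ b → SameBlock _≟_ Π a b
    → Setup _≟_ (remove _≟_ b S) θ
      × PBPair _≟_ (remove _≟_ b S) θ (Paθa _≟_ S θ P a b) (delPart _≟_ b Π)
mainTheorem1 _≟_ S θ P Π a b (S! , θS-disjoint , θ-involutive) ((P-closed , P-injective) , P-mirrored , Π-partition)
             a∈S b∈S a≢b _ =
  setup′ , reduced-isPerm , reduced-cyclesMirrored , delPart-partition _≟_ b Π-partition
  where open Reduction _≟_ S θ P a b S! θS-disjoint θ-involutive P-closed P-injective P-mirrored a∈S b∈S a≢b
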